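{- Let $n,k,s$ be positive integers with $k\le n$. Write $k=qs+r$ with integers $q,r\ge0$ and $r<s$, and let $\lambda=\lambda(k,s)=((q+1)^r,q^{s-r})$ be the partition of $k$ with $s$ parts consisting of $r$ copies of $q+1$ followed by $s-r$ copies of $q$. Then $I_{n,k,s}=I_{n,\lambda}$, and hence $R_{n,k,s}=R_{n,\lambda}$.
   Context: $I_{n,k,s}=\langle e_n(\mathbf{x}_n),e_{n-1}(\mathbf{x}_n),\dots,e_{n-k+1}(\mathbf{x}_n),x_1^s,\dots,x_n^s\rangle\subseteq\mathbb{Q}[x_1,\dots,x_n]$, where $e_d(\mathbf{x}_n)$ is the elementary symmetric polynomial of degree $d$ in $x_1,\dots,x_n$; $R_{n,k,s}=\mathbb{Q}[x_1,\dots,x_n]/I_{n,k,s}$. For a partition $\lambda=(\lambda_1\ge\cdots\ge\lambda_s\ge0)$ of $k\le n$ with $s$ parts (zeros allowed), $\lambda'=(\lambda'_1,\dots,\lambda'_n)$ is its conjugate padded with zeros to length $n$; for $S\subseteq[n]$, $e_d(S)$ is the degree $d$ elementary symmetric polynomial in $\{x_i:i\in S\}$ (zero if $d>|S|$); $I_{n,\lambda}$ is generated by $x_1^s,\dots,x_n^s$ and all $e_d(S)$ with $S\subseteq[n]$, $d>|S|-\lambda'_n-\cdots-\lambda'_{n-|S|+1}$; $R_{n,\lambda}=\mathbb{Q}[x_1,\dots,x_n]/I_{n,\lambda}$. -}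

module Defs where

open import Data.Nat as ℕ using (ℕ; zero; suc; _≤_; _<_; _/_; _%_; _≤?_)
open import Data.Rational as ℚ using (ℚ; 0ℚ; 1ℚ)
open import Data.Fin using (Fin)
open import Data.Fin.Subset using (Subset; _∈_; ∣_∣)
open import Data.Fin.Subset.Properties using (_∈?_)
open import Data.Vec as Vec using (Vec; replicate; zipWith; updateAt)
open import Data.Vec.Properties using (≡-dec)
open import Data.List as List using (List; []; _∷_; _++_; concatMap; map; filter; allFin; upTo; length)
open import Data.List.Relation.Unary.All using (All)
open import Data.Nat.ListAction using () renaming (sum to sumℕ)
open import Data.Product using (Σ; _×_; _,_; proj₁; proj₂)
open import Relation.Binary.PropositionalEquality using (_≡_)
open import Relation.Nullary using (yes; no)
open import Function.Bundles using (_⇔_)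

-- Polynomials in ℚ[x₁,…,xₙ] as finite lists of terms (coefficient,
-- exponent vector); equality is equality of all coefficients.

Mono : ℕ → Set
Mono n = Vec ℕ n

Poly : ℕ → Set
Poly n = List (ℚ × Mono n)

coeff : ∀ {n} → Poly n → Mono n → ℚ
coeff [] m = 0ℚ
coeff ((c , m') ∷ p) m with ≡-dec ℕ._≟_ m' m
... | yes _ = c ℚ.+ coeff p m
... | no  _ = coeff p m

infix 4 _≈P_
_≈P_ : ∀ {n} → Poly n → Poly n → Set
p ≈P q = ∀ m → coeff p m ≡ coeff q m

0P : ∀ {n} → Poly n
0P = []

1P : ∀ {n} → Poly n
1P = (1ℚ , replicate _ 0) ∷ []

infixl 6 _+P_
infixl 7 _*P_
_+P_ : ∀ {n} → Poly n → Poly n → Poly n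
p +P q = p ++ q

_*P_ : ∀ {n} → Poly n → Poly n → Poly n
p *P q = concatMap (λ { (c , m) → map (λ { (d , m') → (c ℚ.* d , zipWith ℕ._+_ m m') }) q }) p

varPow : ∀ {n} → Fin n → ℕ → Poly n
varPow i e = (1ℚ , updateAt (replicate _ 0) i (λ _ → e)) ∷ []

esymL : ∀ {n} → ℕ → List (Fin n) → Poly n
esymL zero    _        = 1P
esymL (suc d) []       = 0P
esymL (suc d) (i ∷ is) = varPow i 1 *P esymL d is +P esymL (suc d) is

esymS : ∀ {n} → ℕ → Subset n → Poly n
esymS {n} d S = esymL d (filter (_∈? S) (allFin n))

esym : ∀ {n} → ℕ → Poly n
esym {n} d = esymL d (allFin n)

-- Ideal generated by a (possibly infinite) set of polynomials given as a
-- predicate: f is a finite combination Σ cᵢ gᵢ with each gᵢ a generator.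

sumComb : ∀ {n} → List (Poly n × Poly n) → Poly n
sumComb [] = 0P
sumComb ((c , g) ∷ ts) = c *P g +P sumComb ts

InIdeal : ∀ {n} → (Poly n → Set) → Poly n → Set
InIdeal {n} G f = Σ (List (Poly n × Poly n)) λ ts → All (λ t → G (proj₂ t)) ts × f ≈P sumComb ts

SameIdeal : ∀ {n} → (Poly n → Set) → (Poly n → Set) → Set
SameIdeal {n} G H = (f : Poly n) → InIdeal G f ⇔ InIdeal H f

GenNKS : (n k s : ℕ) → Poly n → Set
GenNKS n k s g =
  Σ ℕ (λ d → (suc n ℕ.∸ k ≤ d) × (d ≤ n) × (g ≡ esym d))
  ⊎' Σ (Fin n) (λ i → g ≡ varPow i s)
  where
  open import Data.Sum using () renaming (_⊎_ to _⊎'_)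

conj : List ℕ → ℕ → ℕ
conj lam j = length (filter (j ≤?_) lam)

tailConjSum : List ℕ → ℕ → ℕ → ℕ
tailConjSum lam n m = sumℕ (map (λ t → conj lam (n ℕ.∸ t)) (upTo m))

-- generators of I_{n,λ} (s = number of parts of λ, zeros allowed):
-- x_i^s, and e_d(S) whenever d > |S| - (λ'_n + ⋯ + λ'_{n-|S|+1}),
-- the inequality read over ℤ, i.e. d + (λ'_n+⋯) > |S|.
GenLam : (n s : ℕ) → List ℕ → Poly n → Set
GenLam n s lam g =
  Σ (Subset n) (λ S → Σ ℕ (λ d →
      (∣ S ∣ < d ℕ.+ tailConjSum lam n ∣ S ∣) × (g ≡ esymS d S)))
  ⊎' Σ (Fin n) (λ i → g ≡ varPow i s)
  where
  open import Data.Sum using () renaming (_⊎_ to _⊎'_)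

lamKS : ℕ → ℕ → List ℕ
lamKS k zero = []
lamKS k (suc s') =
  List.replicate (k % suc s') (suc (k / suc s'))
  ++ List.replicate (suc s' ℕ.∸ k % suc s') (k / suc s')

module Submission where

-- Write T(m) = λ'_n + ⋯ + λ'_{n-m+1}.  The conjugate of λ
-- is (s^q, r, 0, …), so the tail sums telescope to T(m) = k ∸ (n - m)·s.  Hence
-- T(n) = k, and each generator e_d (d ≥ n - k + 1) of I_{n,k,s} is the generator
-- e_d([n]) of I_{n,λ}.  Conversely, from the recursion
--   e_{d+1}(L with y inserted) = y·e_d(L) + e_{d+1}(L)
-- and y^s ∈ I_{n,k,s}: if e_d(L with y) ∈ I for all d ≥ c, then e_d(L) ∈ I for
-- all d ≥ c + s - 1 (deletion lemma).  Deleting the n - |S| variables outside S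
-- from [n], where e_d ∈ I for d ≥ n - k + 1, gives e_d(S) ∈ I once
-- d ≥ n - k + 1 + (n - |S|)(s - 1), which the condition |S| < d + T(|S|) implies.

open import Defs
open import Data.Nat as ℕ using (ℕ; zero; suc; _+_; _*_; _≤_; _<_; s≤s; _∸_; _≤?_; _/_; _%_)
import Data.Nat.Properties as NP
open import Data.Nat.DivMod using (m≡m%n+[m/n]*n; m%n<n)
open import Data.Nat.Tactic.RingSolver using (solve-∀)
open import Data.Nat.ListAction using () renaming (sum to sumℕ)
import Data.Nat.ListAction.Properties as SumP
open import Data.Rational as ℚ using (ℚ; 0ℚ; 1ℚ)
import Data.Rational.Properties as ℚP
open import Data.Fin using (Fin; zero; suc)
open import Data.Fin.Subset using (Subset; inside; outside; ⊤; ∣_∣)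
open import Data.Fin.Subset.Properties using (_∈?_; ∈⊤; ∣⊤∣≡n; ∣p∣≤n)
open import Data.Vec as Vec using ([]; _∷_; zipWith)
open import Data.Vec.Properties using (≡-dec; ∷-injective)
open import Data.List as List using (List; []; _∷_; _++_; map; length; filter; allFin; upTo)
import Data.List.Properties as LP
open import Data.List.Relation.Unary.All using (All; []; _∷_; universal)
import Data.List.Relation.Unary.All.Properties as AllP
open import Data.List.Relation.Binary.Sublist.Propositional using (_⊆_; []; _∷_; _∷ʳ_)
open import Data.List.Relation.Binary.Sublist.Propositional.Properties using (filter-⊆; length-mono-≤)
open import Data.Product using (Σ; _×_; _,_; proj₁; proj₂)
open import Data.Sum using (inj₁; inj₂)
open import Data.Bool using (true; false)
open import Data.Empty using (⊥-elim)
open import Relation.Nullary using (yes; no; ¬_; Dec; does)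
open import Relation.Binary.Bundles using (Setoid)
import Relation.Binary.Reasoning.Setoid as SetoidReasoning
open import Relation.Binary.Definitions using (tri<; tri≈; tri>)
open import Relation.Binary.PropositionalEquality
open import Function.Bundles using (mk⇔)
open import Level using (0ℓ)

Term : ℕ → Set
Term n = ℚ × Mono n

_⊕_ : ∀ {n} → Mono n → Mono n → Mono n
u ⊕ v = zipWith ℕ._+_ u v

_·_ : ∀ {n} → Term n → Term n → Term n
(a , u) · (b , v) = (a ℚ.* b , u ⊕ v)

scale : ∀ {n} → Term n → Poly n → Poly n
scale t = map (t ·_)

zeros : ∀ {n} → Mono n
zeros = Vec.replicate _ 0

xPow : ∀ {n} → Fin n → ℕ → Term n
xPow i e = (1ℚ , Vec.updateAt zeros i (λ _ → e))

⊕-assoc : ∀ {n} (u v w : Mono n) → u ⊕ (v ⊕ w) ≡ (u ⊕ v) ⊕ w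
⊕-assoc [] [] [] = refl
⊕-assoc (x ∷ u) (y ∷ v) (z ∷ w) = cong₂ _∷_ (sym (NP.+-assoc x y z)) (⊕-assoc u v w)

⊕-comm : ∀ {n} (u v : Mono n) → u ⊕ v ≡ v ⊕ u
⊕-comm [] [] = refl
⊕-comm (x ∷ u) (y ∷ v) = cong₂ _∷_ (NP.+-comm x y) (⊕-comm u v)

⊕-identityˡ : ∀ {n} (u : Mono n) → zeros ⊕ u ≡ u
⊕-identityˡ [] = refl
⊕-identityˡ (x ∷ u) = cong (x ∷_) (⊕-identityˡ u)

⊕-cancelˡ : ∀ {n} (u v w : Mono n) → u ⊕ v ≡ u ⊕ w → v ≡ w
⊕-cancelˡ [] [] [] e = refl
⊕-cancelˡ (x ∷ u) (y ∷ v) (z ∷ w) e =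
  cong₂ _∷_ (NP.+-cancelˡ-≡ x y z (proj₁ (∷-injective e))) (⊕-cancelˡ u v w (proj₂ (∷-injective e)))

divides? : ∀ {n} (u m : Mono n) → Dec (Σ (Mono n) λ v → u ⊕ v ≡ m)
divides? [] [] = yes ([] , refl)
divides? (x ∷ u) (y ∷ m) with x ℕ.≤? y | divides? u m
... | yes x≤y | yes (v , e) = yes ((y ∸ x) ∷ v , cong₂ _∷_ (NP.m+[n∸m]≡n x≤y) e)
... | no x≰y | _ = no λ { (z ∷ v , e) → x≰y (subst (x ≤_) (proj₁ (∷-injective e)) (NP.m≤m+n x z)) }
... | yes _ | no ¬v = no λ { (z ∷ v , e) → ¬v (v , proj₂ (∷-injective e)) }

·-assoc : ∀ {n} (t u v : Term n) → t · (u · v) ≡ (t · u) · v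
·-assoc (a , x) (b , y) (c , z) = cong₂ _,_ (sym (ℚP.*-assoc a b c)) (⊕-assoc x y z)

·-comm : ∀ {n} (t u : Term n) → t · u ≡ u · t
·-comm (a , x) (b , y) = cong₂ _,_ (ℚP.*-comm a b) (⊕-comm x y)

xPow-· : ∀ {n} (y : Fin n) a b → xPow y a · xPow y b ≡ xPow y (a + b)
xPow-· y a b = cong₂ _,_ (ℚP.*-identityˡ 1ℚ) (exponents y)
  where
  exponents : ∀ {n} (y : Fin n) → Vec.updateAt zeros y (λ _ → a) ⊕ Vec.updateAt zeros y (λ _ → b)
                                  ≡ Vec.updateAt zeros y (λ _ → a + b)
  exponents {suc n} zero = cong ((a + b) ∷_) (⊕-identityˡ zeros)
  exponents {suc n} (suc y) = cong (0 ∷_) (exponents y)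

xPow-zero : ∀ {n} (y : Fin n) → xPow y 0 ≡ (1ℚ , zeros)
xPow-zero y = cong (1ℚ ,_) (exponent y)
  where
  exponent : ∀ {n} (y : Fin n) → Vec.updateAt zeros y (λ _ → 0) ≡ zeros
  exponent {suc n} zero = refl
  exponent {suc n} (suc y) = cong (0 ∷_) (exponent y)

≈P-setoid : ℕ → Setoid 0ℓ 0ℓ
≈P-setoid n = record
  { Carrier = Poly n
  ; _≈_ = _≈P_
  ; isEquivalence = record
    { refl = λ _ → refl ; sym = λ e m → sym (e m) ; trans = λ e e′ m → trans (e m) (e′ m) } }

module ≈P-Reasoning {n : ℕ} = SetoidReasoning (≈P-setoid n)

≈P-refl : ∀ {n} {f : Poly n} → f ≈P f
≈P-refl _ = refl

≡⇒≈P : ∀ {n} {f g : Poly n} → f ≡ g → f ≈P g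
≡⇒≈P refl _ = refl

coeff-+P : ∀ {n} (f g : Poly n) m → coeff (f +P g) m ≡ coeff f m ℚ.+ coeff g m
coeff-+P [] g m = sym (ℚP.+-identityˡ _)
coeff-+P ((c , m′) ∷ f) g m with ≡-dec ℕ._≟_ m′ m
... | yes _ = trans (cong (c ℚ.+_) (coeff-+P f g m)) (sym (ℚP.+-assoc c _ _))
... | no _ = coeff-+P f g m

+P-cong : ∀ {n} {f f′ g g′ : Poly n} → f ≈P f′ → g ≈P g′ → f +P g ≈P f′ +P g′
+P-cong {f = f} {f′} {g} {g′} e e′ m =
  trans (coeff-+P f g m) (trans (cong₂ ℚ._+_ (e m) (e′ m)) (sym (coeff-+P f′ g′ m)))

+P-comm : ∀ {n} (f g : Poly n) → f +P g ≈P g +P f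
+P-comm f g m = trans (coeff-+P f g m) (trans (ℚP.+-comm (coeff f m) (coeff g m)) (sym (coeff-+P g f m)))

+P-swapˡ : ∀ {n} (f g h : Poly n) → f +P (g +P h) ≈P g +P (f +P h)
+P-swapˡ f g h = begin
  f +P (g +P h) ≡⟨ LP.++-assoc f g h ⟨
  (f +P g) +P h ≈⟨ +P-cong {f = f +P g} {g +P f} {h} {h} (+P-comm f g) (≈P-refl {f = h}) ⟩
  (g +P f) +P h ≡⟨ LP.++-assoc g f h ⟩
  g +P (f +P h) ∎
  where open ≈P-Reasoning

+P-interchange : ∀ {n} (f g h k : Poly n) → (f +P g) +P (h +P k) ≈P (f +P h) +P (g +P k)
+P-interchange f g h k = begin
  (f +P g) +P (h +P k) ≡⟨ LP.++-assoc f g (h +P k) ⟩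
  f +P (g +P (h +P k)) ≈⟨ +P-cong {f = f} {f} {g +P (h +P k)} {h +P (g +P k)} (≈P-refl {f = f}) (+P-swapˡ g h k) ⟩
  f +P (h +P (g +P k)) ≡⟨ LP.++-assoc f h (g +P k) ⟨
  (f +P h) +P (g +P k) ∎
  where open ≈P-Reasoning

coeff-scale-divisible : ∀ {n} a (u v m : Mono n) (f : Poly n) → u ⊕ v ≡ m →
  coeff (scale (a , u) f) m ≡ a ℚ.* coeff f v
coeff-scale-divisible a u v m [] e = sym (ℚP.*-zeroʳ a)
coeff-scale-divisible a u v m ((d , w) ∷ f) e with ≡-dec ℕ._≟_ (u ⊕ w) m | ≡-dec ℕ._≟_ w v
... | yes _ | yes _ =
  trans (cong (a ℚ.* d ℚ.+_) (coeff-scale-divisible a u v m f e)) (sym (ℚP.*-distribˡ-+ a d _))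
... | yes e′ | no w≢v = ⊥-elim (w≢v (⊕-cancelˡ u w v (trans e′ (sym e))))
... | no ne | yes w≡v = ⊥-elim (ne (trans (cong (u ⊕_) w≡v) e))
... | no _ | no _ = coeff-scale-divisible a u v m f e

coeff-scale-indivisible : ∀ {n} a (u m : Mono n) (f : Poly n) → ¬ (Σ (Mono n) λ v → u ⊕ v ≡ m) →
  coeff (scale (a , u) f) m ≡ 0ℚ
coeff-scale-indivisible a u m [] _ = refl
coeff-scale-indivisible a u m ((d , w) ∷ f) ¬v with ≡-dec ℕ._≟_ (u ⊕ w) m
... | yes e = ⊥-elim (¬v (w , e))
... | no _ = coeff-scale-indivisible a u m f ¬v

scale-cong : ∀ {n} (t : Term n) {f g : Poly n} → f ≈P g → scale t f ≈P scale t g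
scale-cong (a , u) {f} {g} e m with divides? u m
... | yes (v , uv) = trans (coeff-scale-divisible a u v m f uv)
                      (trans (cong (a ℚ.*_) (e v)) (sym (coeff-scale-divisible a u v m g uv)))
... | no ¬v = trans (coeff-scale-indivisible a u m f ¬v) (sym (coeff-scale-indivisible a u m g ¬v))

coeff-scale-neg : ∀ {n} (f : Poly n) m → coeff (scale (ℚ.- 1ℚ , zeros) f) m ≡ ℚ.- coeff f m
coeff-scale-neg f m = trans (coeff-scale-divisible (ℚ.- 1ℚ) zeros m m f (⊕-identityˡ m))
  (trans (sym (ℚP.neg-distribˡ-* 1ℚ (coeff f m))) (cong ℚ.-_ (ℚP.*-identityˡ _)))

scale-+P : ∀ {n} (t : Term n) (f g : Poly n) → scale t (f +P g) ≡ scale t f +P scale t g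
scale-+P t = LP.map-++ (t ·_)

scale-scale : ∀ {n} (t u : Term n) (f : Poly n) → scale t (scale u f) ≡ scale (t · u) f
scale-scale t u [] = refl
scale-scale t u (v ∷ f) = cong₂ _∷_ (·-assoc t u v) (scale-scale t u f)

scale-comm : ∀ {n} (t u : Term n) (f : Poly n) → scale t (scale u f) ≡ scale u (scale t f)
scale-comm t u f =
  trans (scale-scale t u f) (trans (cong (λ w → scale w f) (·-comm t u)) (sym (scale-scale u t f)))

scale-unit : ∀ {n} (f : Poly n) → scale (1ℚ , zeros) f ≡ f
scale-unit [] = refl
scale-unit ((d , v) ∷ f) = cong₂ _∷_ (cong₂ _,_ (ℚP.*-identityˡ d) (⊕-identityˡ v)) (scale-unit f)

scale-*P : ∀ {n} (t : Term n) (c g : Poly n) → scale t (c *P g) ≡ scale t c *P g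
scale-*P t [] g = refl
scale-*P t (u ∷ c) g =
  trans (scale-+P t (scale u g) (c *P g)) (cong₂ _+P_ (scale-scale t u g) (scale-*P t c g))

*P-single : ∀ {n} (f : Poly n) (t : Term n) → f *P (t ∷ []) ≡ scale t f
*P-single [] t = refl
*P-single (u ∷ f) t = cong₂ _∷_ (·-comm u t) (*P-single f t)

varPow-*P : ∀ {n} (i : Fin n) e (f : Poly n) → varPow i e *P f ≡ scale (xPow i e) f
varPow-*P i e f = LP.++-identityʳ (scale (xPow i e) f)

sumComb-++ : ∀ {n} (ts us : List (Poly n × Poly n)) → sumComb (ts ++ us) ≡ sumComb ts +P sumComb us
sumComb-++ [] us = refl
sumComb-++ ((c , g) ∷ ts) us =
  trans (cong (c *P g +P_) (sumComb-++ ts us)) (sym (LP.++-assoc (c *P g) _ _))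

module Ideal {n} (G : Poly n → Set) where

  Mem : Poly n → Set
  Mem = InIdeal G

  mem-resp : ∀ {f g} → f ≈P g → Mem f → Mem g
  mem-resp e (ts , gens , e′) = ts , gens , λ m → trans (sym (e m)) (e′ m)

  mem-0 : Mem 0P
  mem-0 = [] , [] , ≈P-refl {f = 0P}

  mem-vanishing : ∀ {f} → f ≈P 0P → Mem f
  mem-vanishing {f} e = mem-resp {0P} {f} (λ m → sym (e m)) mem-0

  mem-gen : ∀ {g} → G g → Mem g
  mem-gen {g} x = ((1P , g) ∷ []) , (x ∷ []) ,
    ≡⇒≈P (sym (trans (LP.++-identityʳ _) (trans (LP.++-identityʳ _) (scale-unit g))))

  mem-+P : ∀ {f g} → Mem f → Mem g → Mem (f +P g)
  mem-+P {f} {g} (ts , as , e) (us , bs , e′) = ts ++ us , AllP.++⁺ as bs , λ m → begin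
    coeff (f +P g) m                      ≡⟨ +P-cong {f = f} {sumComb ts} {g} {sumComb us} e e′ m ⟩
    coeff (sumComb ts +P sumComb us) m    ≡⟨ cong (λ h → coeff h m) (sumComb-++ ts us) ⟨
    coeff (sumComb (ts ++ us)) m          ∎
    where open ≡-Reasoning

  mem-scale : ∀ t {f} → Mem f → Mem (scale t f)
  mem-scale t {f} (ts , gens , e) =
    scaled ts , AllP.map⁺ gens ,
    λ m → trans (scale-cong t {f} {sumComb ts} e m) (cong (λ h → coeff h m) (scale-sumComb ts))
    where
    scaled : List (Poly n × Poly n) → List (Poly n × Poly n)
    scaled = map (λ cg → scale t (proj₁ cg) , proj₂ cg)
    scale-sumComb : ∀ ts → scale t (sumComb ts) ≡ sumComb (scaled ts)
    scale-sumComb [] = refl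
    scale-sumComb ((c , g) ∷ ts) =
      trans (scale-+P t (c *P g) (sumComb ts)) (cong₂ _+P_ (scale-*P t c g) (scale-sumComb ts))

  mem-*P : ∀ (c : Poly n) {f} → Mem f → Mem (c *P f)
  mem-*P [] _ = mem-0
  mem-*P (t ∷ c) {f} x = mem-+P {scale t f} {c *P f} (mem-scale t {f} x) (mem-*P c x)

  mem-difference : ∀ {f g h} → f ≈P g +P h → Mem f → Mem g → Mem h
  mem-difference {f} {g} {h} e mf mg =
    mem-resp {f +P -g} {h} difference (mem-+P {f} { -g} mf (mem-scale (ℚ.- 1ℚ , zeros) {g} mg))
    where
    cancel : ∀ u v → (u ℚ.+ v) ℚ.+ ℚ.- u ≡ v
    cancel u v = begin
      (u ℚ.+ v) ℚ.+ ℚ.- u ≡⟨ cong (ℚ._+ ℚ.- u) (ℚP.+-comm u v) ⟩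
      (v ℚ.+ u) ℚ.+ ℚ.- u ≡⟨ ℚP.+-assoc v u (ℚ.- u) ⟩
      v ℚ.+ (u ℚ.+ ℚ.- u) ≡⟨ cong (v ℚ.+_) (ℚP.+-inverseʳ u) ⟩
      v ℚ.+ 0ℚ            ≡⟨ ℚP.+-identityʳ v ⟩
      v                   ∎
      where open ≡-Reasoning
    -g : Poly n
    -g = scale (ℚ.- 1ℚ , zeros) g
    difference : f +P -g ≈P h
    difference m = begin
      coeff (f +P -g) m                           ≡⟨ coeff-+P f -g m ⟩
      coeff f m ℚ.+ coeff -g m
        ≡⟨ cong₂ ℚ._+_ (trans (e m) (coeff-+P g h m)) (coeff-scale-neg g m) ⟩
      (coeff g m ℚ.+ coeff h m) ℚ.+ ℚ.- coeff g m ≡⟨ cancel (coeff g m) (coeff h m) ⟩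
      coeff h m                                   ∎
      where open ≡-Reasoning

ideal-mono : ∀ {n} {G H : Poly n → Set} → (∀ {g} → G g → InIdeal H g) → ∀ {f} → InIdeal G f → InIdeal H f
ideal-mono {n} {G} {H} gens⊆ {f} (ts , gens , e) =
  mem-resp {sumComb ts} {f} (λ m → sym (e m)) (combination ts gens)
  where
  open Ideal H
  combination : ∀ ts → All (λ t → G (proj₂ t)) ts → Mem (sumComb ts)
  combination [] [] = mem-0
  combination ((c , g) ∷ ts) (x ∷ gens) =
    mem-+P {c *P g} {sumComb ts} (mem-*P c (gens⊆ x)) (combination ts gens)

esym-insert : ∀ {n} (y : Fin n) (p L : List (Fin n)) d →
  esymL (suc d) (p ++ y ∷ L) ≈P scale (xPow y 1) (esymL d (p ++ L)) +P esymL (suc d) (p ++ L)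
esym-insert y [] L d = ≡⇒≈P (cong (_+P esymL (suc d) L) (varPow-*P y 1 (esymL d L)))
esym-insert y (j ∷ p) L zero = begin
  x₁ +P esymL 1 (p ++ y ∷ L)
    ≈⟨ +P-cong {f = x₁} {x₁} {esymL 1 (p ++ y ∷ L)} {y₁ +P esymL 1 (p ++ L)}
               (≈P-refl {f = x₁}) (esym-insert y p L zero) ⟩
  x₁ +P (y₁ +P esymL 1 (p ++ L))
    ≈⟨ +P-swapˡ x₁ y₁ (esymL 1 (p ++ L)) ⟩
  y₁ +P (x₁ +P esymL 1 (p ++ L)) ∎
  where
  open ≈P-Reasoning
  x₁ y₁ : Poly _
  x₁ = varPow j 1 *P 1P
  y₁ = scale (xPow y 1) 1P
esym-insert y (j ∷ p) L (suc d) = begin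
  varPow j 1 *P B₁ +P B₂
    ≡⟨ cong (_+P B₂) (varPow-*P j 1 B₁) ⟩
  scale xⱼ B₁ +P B₂
    ≈⟨ +P-cong {f = scale xⱼ B₁} {scale xⱼ (scale yₓ A₀ +P A₁)} {B₂} {scale yₓ A₁ +P A₂}
               (scale-cong xⱼ {B₁} {scale yₓ A₀ +P A₁} (esym-insert y p L d)) (esym-insert y p L (suc d)) ⟩
  scale xⱼ (scale yₓ A₀ +P A₁) +P (scale yₓ A₁ +P A₂)
    ≡⟨ cong (_+P (scale yₓ A₁ +P A₂))
         (trans (scale-+P xⱼ (scale yₓ A₀) A₁) (cong (_+P scale xⱼ A₁) (scale-comm xⱼ yₓ A₀))) ⟩
  (scale yₓ (scale xⱼ A₀) +P scale xⱼ A₁) +P (scale yₓ A₁ +P A₂)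
    ≈⟨ +P-interchange (scale yₓ (scale xⱼ A₀)) (scale xⱼ A₁) (scale yₓ A₁) A₂ ⟩
  (scale yₓ (scale xⱼ A₀) +P scale yₓ A₁) +P (scale xⱼ A₁ +P A₂)
    ≡⟨ cong₂ _+P_ (sym (scale-+P yₓ (scale xⱼ A₀) A₁)) (cong (_+P A₂) (sym (varPow-*P j 1 A₁))) ⟩
  scale yₓ (scale xⱼ A₀ +P A₁) +P (varPow j 1 *P A₁ +P A₂)
    ≡⟨ cong (λ h → scale yₓ (h +P A₁) +P (varPow j 1 *P A₁ +P A₂)) (sym (varPow-*P j 1 A₀)) ⟩
  scale yₓ (varPow j 1 *P A₀ +P A₁) +P (varPow j 1 *P A₁ +P A₂) ∎
  where
  open ≈P-Reasoning
  xⱼ yₓ : Term _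
  xⱼ = xPow j 1
  yₓ = xPow y 1
  B₁ B₂ A₀ A₁ A₂ : Poly _
  B₁ = esymL (suc d) (p ++ y ∷ L)
  B₂ = esymL (suc (suc d)) (p ++ y ∷ L)
  A₀ = esymL d (p ++ L)
  A₁ = esymL (suc d) (p ++ L)
  A₂ = esymL (suc (suc d)) (p ++ L)

esym-insert-scaled : ∀ {n} (y : Fin n) (p L : List (Fin n)) a d →
  scale (xPow y a) (esymL (suc d) (p ++ y ∷ L))
    ≈P scale (xPow y (suc a)) (esymL d (p ++ L)) +P scale (xPow y a) (esymL (suc d) (p ++ L))
esym-insert-scaled y p L a d = begin
  scale yᵃ (esymL (suc d) (p ++ y ∷ L))
    ≈⟨ scale-cong yᵃ {esymL (suc d) (p ++ y ∷ L)} {scale (xPow y 1) A₀ +P A₁} (esym-insert y p L d) ⟩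
  scale yᵃ (scale (xPow y 1) A₀ +P A₁)
    ≡⟨ scale-+P yᵃ (scale (xPow y 1) A₀) A₁ ⟩
  scale yᵃ (scale (xPow y 1) A₀) +P scale yᵃ A₁
    ≡⟨ cong (_+P scale yᵃ A₁) (trans (scale-scale yᵃ (xPow y 1) A₀) (cong (λ t → scale t A₀) yᵃ·y≡yᵃ⁺¹)) ⟩
  scale (xPow y (suc a)) A₀ +P scale yᵃ A₁ ∎
  where
  open ≈P-Reasoning
  yᵃ : Term _
  yᵃ = xPow y a
  A₀ A₁ : Poly _
  A₀ = esymL d (p ++ L)
  A₁ = esymL (suc d) (p ++ L)
  yᵃ·y≡yᵃ⁺¹ : yᵃ · xPow y 1 ≡ xPow y (suc a)
  yᵃ·y≡yᵃ⁺¹ = trans (xPow-· y a 1) (cong (xPow y) (NP.+-comm a 1))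

esym-vanish : ∀ {n} d (L : List (Fin n)) → length L < d → esymL d L ≈P 0P
esym-vanish (suc d) [] _ = ≈P-refl {f = 0P}
esym-vanish (suc d) (i ∷ L) (s≤s |L|<d) = begin
  varPow i 1 *P esymL d L +P esymL (suc d) L
    ≡⟨ cong (_+P esymL (suc d) L) (varPow-*P i 1 (esymL d L)) ⟩
  scale (xPow i 1) (esymL d L) +P esymL (suc d) L
    ≈⟨ +P-cong {f = scale (xPow i 1) (esymL d L)} {0P} {esymL (suc d) L} {0P}
               (scale-cong (xPow i 1) {esymL d L} {0P} (esym-vanish d L |L|<d))
               (esym-vanish (suc d) L (NP.m≤n⇒m≤1+n |L|<d)) ⟩
  0P ∎
  where open ≈P-Reasoning

-- The deletion lemma: in an ideal containing x_y^s for all y, the range of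
-- degrees d for which e_d lies in the ideal shrinks by s - 1 per deleted variable

module Deletion {n} (G : Poly n → Set) (s′ : ℕ) (power-mem : ∀ y → InIdeal G (varPow y (suc s′))) where
  open Ideal G

  power-multiple : ∀ y f → Mem (scale (xPow y (suc s′)) f)
  power-multiple y f = subst Mem (*P-single f (xPow y (suc s′))) (mem-*P f (power-mem y))

  module _ (y : Fin n) (p L : List (Fin n)) (c : ℕ)
           (hyp : ∀ d → c ≤ d → Mem (esymL d (p ++ y ∷ L))) where

    shrink : ∀ {j d} → c + suc j ≤ suc d → c + j ≤ d
    shrink {j} {d} le = NP.≤-pred (subst (_≤ suc d) (NP.+-suc c j) le)

    -- y^a·e_d(p ++ L) ∈ I whenever j + a = s and d + 1 ≥ c + j, by induction on j,
    -- using y^a·e_{d+1}(p ++ L) = y^a·e_{d+1}(p ++ y ∷ L) - y^(a+1)·e_d(p ++ L)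
    descend : ∀ j a → j + a ≡ suc s′ → ∀ d → c + j ≤ suc d → Mem (scale (xPow y a) (esymL d (p ++ L)))
    descend zero a refl d _ = power-multiple y (esymL d (p ++ L))
    descend (suc j) a _ zero le = mem-scale (xPow y a) {1P} (hyp 0 (NP.m+n≤o⇒m≤o c (shrink le)))
    descend (suc j) a j+a≡s (suc d) le =
      mem-difference {scale (xPow y a) (esymL (suc d) (p ++ y ∷ L))}
                     {scale (xPow y (suc a)) (esymL d (p ++ L))}
                     {scale (xPow y a) (esymL (suc d) (p ++ L))}
        (esym-insert-scaled y p L a d)
        (mem-scale (xPow y a) {esymL (suc d) (p ++ y ∷ L)}
          (hyp (suc d) (NP.m+n≤o⇒m≤o c (shrink le))))
        (descend j (suc a) (trans (NP.+-suc j a) j+a≡s) d (shrink le))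

    delete-one : ∀ d → c + s′ ≤ d → Mem (esymL d (p ++ L))
    delete-one d le = subst Mem (trans (cong (λ t → scale t (esymL d (p ++ L))) (xPow-zero y)) (scale-unit _))
      (descend (suc s′) 0 (NP.+-identityʳ (suc s′)) d (subst (_≤ suc d) (sym (NP.+-suc c s′)) (s≤s le)))

  delete-all : ∀ {l L : List (Fin n)} → l ⊆ L → ∀ p c → (∀ d → c ≤ d → Mem (esymL d (p ++ L))) →
    ∀ d → c + (length L ∸ length l) * s′ ≤ d → Mem (esymL d (p ++ l))
  delete-all [] p c hyp d le = hyp d (subst (_≤ d) (NP.+-identityʳ c) le)
  -- a kept variable moves into the prefix p; a deleted one is removed by delete-one
  delete-all {x ∷ l} {x ∷ L} (refl ∷ l⊆L) p c hyp d le =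
    subst (λ q → Mem (esymL d q)) (LP.++-assoc p (x ∷ []) l)
      (delete-all l⊆L (p ++ x ∷ []) c moved d le)
    where
    moved : ∀ d → c ≤ d → Mem (esymL d ((p ++ x ∷ []) ++ L))
    moved d c≤d = subst (λ q → Mem (esymL d q)) (sym (LP.++-assoc p (x ∷ []) L)) (hyp d c≤d)
  delete-all {l} {x ∷ L} (x ∷ʳ l⊆L) p c hyp d le =
    delete-all l⊆L p (c + s′) (delete-one x p L c hyp) d (subst (_≤ d) budget le)
    where
    budget : c + (suc (length L) ∸ length l) * s′ ≡ c + s′ + (length L ∸ length l) * s′
    budget = trans (cong (λ e → c + e * s′) (NP.+-∸-assoc 1 (length-mono-≤ l⊆L)))
                   (sym (NP.+-assoc c s′ _))

conj-++ : ∀ lam₁ lam₂ j → conj (lam₁ ++ lam₂) j ≡ conj lam₁ j + conj lam₂ j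
conj-++ lam₁ lam₂ j =
  trans (cong length (LP.filter-++ (j ≤?_) lam₁ lam₂)) (LP.length-++ (filter (j ≤?_) lam₁))

conj-replicate-≤ : ∀ j a x → j ≤ x → conj (List.replicate a x) j ≡ a
conj-replicate-≤ j zero x _ = refl
conj-replicate-≤ j (suc a) x j≤x =
  trans (cong length (LP.filter-accept (j ≤?_) j≤x)) (cong suc (conj-replicate-≤ j a x j≤x))

conj-replicate-> : ∀ j a x → x < j → conj (List.replicate a x) j ≡ 0
conj-replicate-> j zero x _ = refl
conj-replicate-> j (suc a) x x<j =
  trans (cong length (LP.filter-reject (j ≤?_) (NP.<⇒≱ x<j))) (conj-replicate-> j a x x<j)

tailConjSum-suc : ∀ lam N m → tailConjSum lam N (suc m) ≡ tailConjSum lam N m + conj lam (N ∸ m)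
tailConjSum-suc lam N m = begin
  sumℕ (map f (upTo (suc m)))       ≡⟨ cong (λ ts → sumℕ (map f ts)) (LP.upTo-∷ʳ m) ⟨
  sumℕ (map f (upTo m ++ m ∷ []))   ≡⟨ cong sumℕ (LP.map-++ f (upTo m) (m ∷ [])) ⟩
  sumℕ (map f (upTo m) ++ f m ∷ []) ≡⟨ SumP.sum-++ (map f (upTo m)) (f m ∷ []) ⟩
  tailConjSum lam N m + (f m + 0)   ≡⟨ cong (tailConjSum lam N m +_) (NP.+-identityʳ (f m)) ⟩
  tailConjSum lam N m + f m         ∎
  where
  open ≡-Reasoning
  f : ℕ → ℕ
  f t = conj lam (N ∸ t)

-- The partition ((q+1)^r, q^(s-r)) of k = r + q·s, whose conjugate is (s^q, r, 0, …)
module Balanced (q r s : ℕ) (r<s : r < s) where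

  k : ℕ
  k = r + q * s

  lam : List ℕ
  lam = List.replicate r (suc q) ++ List.replicate (s ∸ r) q

  conj-≤q : ∀ j → j ≤ q → conj lam j ≡ s
  conj-≤q j j≤q = begin
    conj lam j  ≡⟨ conj-++ (List.replicate r (suc q)) (List.replicate (s ∸ r) q) j ⟩
    conj (List.replicate r (suc q)) j + conj (List.replicate (s ∸ r) q) j
      ≡⟨ cong₂ _+_ (conj-replicate-≤ j r (suc q) (NP.m≤n⇒m≤1+n j≤q))
                   (conj-replicate-≤ j (s ∸ r) q j≤q) ⟩
    r + (s ∸ r) ≡⟨ NP.m+[n∸m]≡n (NP.<⇒≤ r<s) ⟩
    s           ∎
    where open ≡-Reasoning

  conj-1+q : conj lam (suc q) ≡ r
  conj-1+q = begin
    conj lam (suc q) ≡⟨ conj-++ (List.replicate r (suc q)) (List.replicate (s ∸ r) q) (suc q) ⟩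
    conj (List.replicate r (suc q)) (suc q) + conj (List.replicate (s ∸ r) q) (suc q)
      ≡⟨ cong₂ _+_ (conj-replicate-≤ (suc q) r (suc q) NP.≤-refl)
                   (conj-replicate-> (suc q) (s ∸ r) q (NP.n<1+n q)) ⟩
    r + 0            ≡⟨ NP.+-identityʳ r ⟩
    r                ∎
    where open ≡-Reasoning

  conj->1+q : ∀ j → suc q < j → conj lam j ≡ 0
  conj->1+q j 1+q<j =
    trans (conj-++ (List.replicate r (suc q)) (List.replicate (s ∸ r) q) j)
          (cong₂ _+_ (conj-replicate-> j r (suc q) 1+q<j)
                        (conj-replicate-> j (s ∸ r) q (NP.<-trans (NP.n<1+n q) 1+q<j)))

  k<s+qs : k < s + q * s
  k<s+qs = NP.+-monoˡ-< (q * s) r<s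

  -- the conjugate telescopes: λ'_{p+1} = (k ∸ p·s) - (k ∸ (p+1)·s)
  conj-telescope : ∀ p → (k ∸ (s + p * s)) + conj lam (suc p) ≡ k ∸ p * s
  conj-telescope p with NP.<-cmp p q
  ... | tri< p<q _ _ = begin
      (k ∸ (s + p * s)) + conj lam (suc p) ≡⟨ cong ((k ∸ (s + p * s)) +_) (conj-≤q (suc p) p<q) ⟩
      (k ∸ (s + p * s)) + s                ≡⟨ cong (λ z → (k ∸ z) + s) (NP.+-comm s (p * s)) ⟩
      (k ∸ (p * s + s)) + s                ≡⟨ cong (_+ s) (NP.∸-+-assoc k (p * s) s) ⟨
      ((k ∸ p * s) ∸ s) + s                ≡⟨ NP.m∸n+n≡m s≤k∸ps ⟩
      k ∸ p * s                            ∎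
    where
    open ≡-Reasoning
    s≤k∸ps : s ≤ k ∸ p * s
    s≤k∸ps = NP.m+n≤o⇒m≤o∸n s (NP.≤-trans (NP.*-monoˡ-≤ s p<q) (NP.m≤n+m (q * s) r))
  ... | tri≈ _ refl _ = begin
      (k ∸ (s + p * s)) + conj lam (suc p) ≡⟨ cong₂ _+_ (NP.m≤n⇒m∸n≡0 (NP.<⇒≤ k<s+qs)) conj-1+q ⟩
      r                                    ≡⟨ NP.m+n∸n≡m r (p * s) ⟨
      k ∸ p * s                            ∎
    where open ≡-Reasoning
  ... | tri> _ _ q<p = begin
      (k ∸ (s + p * s)) + conj lam (suc p)
        ≡⟨ cong₂ _+_ (NP.m≤n⇒m∸n≡0 (NP.≤-trans (NP.<⇒≤ k<s+qs) (NP.*-monoˡ-≤ s (NP.m≤n⇒m≤1+n q<p))))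
                       (conj->1+q (suc p) (s≤s q<p)) ⟩
      0 ≡⟨ NP.m≤n⇒m∸n≡0 (NP.≤-trans (NP.<⇒≤ k<s+qs) (NP.*-monoˡ-≤ s q<p)) ⟨
      k ∸ p * s ∎
    where open ≡-Reasoning

  tail-sum : ∀ m p → k ≤ (p + m) * s → tailConjSum lam (p + m) m ≡ k ∸ p * s
  tail-sum zero p k≤ps = sym (NP.m≤n⇒m∸n≡0 (subst (λ z → k ≤ z * s) (NP.+-identityʳ p) k≤ps))
  tail-sum (suc m) p k≤ = begin
    tailConjSum lam (p + suc m) (suc m) ≡⟨ cong (λ N → tailConjSum lam N (suc m)) (NP.+-suc p m) ⟩
    tailConjSum lam (suc p + m) (suc m) ≡⟨ tailConjSum-suc lam (suc p + m) m ⟩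
    tailConjSum lam (suc p + m) m + conj lam (suc p + m ∸ m)
      ≡⟨ cong₂ _+_ (tail-sum m (suc p) (subst (λ z → k ≤ z * s) (NP.+-suc p m) k≤))
                     (cong (conj lam) (NP.m+n∸n≡m (suc p) m)) ⟩
    (k ∸ (s + p * s)) + conj lam (suc p) ≡⟨ conj-telescope p ⟩
    k ∸ p * s                            ∎
    where open ≡-Reasoning

tailConjSum-lamKS : ∀ {n k} s′ m → k ≤ n → m ≤ n →
  tailConjSum (lamKS k (suc s′)) n m ≡ k ∸ (n ∸ m) * suc s′
tailConjSum-lamKS {n} {k} s′ m k≤n m≤n = begin
  tailConjSum lam n m           ≡⟨ cong (λ N → tailConjSum lam N m) (NP.m∸n+n≡m m≤n) ⟨
  tailConjSum lam (n ∸ m + m) m ≡⟨ tail-sum m (n ∸ m) bound ⟩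
  B.k ∸ (n ∸ m) * s             ≡⟨ cong (_∸ (n ∸ m) * s) k≡ ⟨
  k ∸ (n ∸ m) * s               ∎
  where
  open ≡-Reasoning
  s : ℕ
  s = suc s′
  module B = Balanced (k / s) (k % s) s (m%n<n k s)
  open B using (lam; tail-sum)
  k≡ : k ≡ B.k
  k≡ = m≡m%n+[m/n]*n k s
  bound : B.k ≤ (n ∸ m + m) * s
  bound = subst₂ (λ a N → a ≤ N * s) k≡ (sym (NP.m∸n+n≡m m≤n)) (NP.≤-trans k≤n (NP.m≤m*n n s))

length-allFin : ∀ n → length (allFin n) ≡ n
length-allFin n = LP.length-tabulate (λ i → i)

filter-∈⊤ : ∀ n → filter (_∈? ⊤) (allFin n) ≡ allFin n
filter-∈⊤ n = LP.filter-all (_∈? ⊤) (universal (λ _ → ∈⊤) (allFin n))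

length-filter-tail : ∀ {n} x (S : Subset n) →
  length (filter (_∈? (x ∷ S)) (List.tabulate {n = n} suc)) ≡ length (filter (_∈? S) (allFin n))
length-filter-tail {n} x S =
  trans (cong (λ L → length (filter (_∈? (x ∷ S)) L)) (sym (LP.map-tabulate (λ i → i) suc)))
        (shift (allFin n))
  where
  shift : ∀ L → length (filter (_∈? (x ∷ S)) (map suc L)) ≡ length (filter (_∈? S) L)
  shift [] = refl
  shift (i ∷ L) with does (i ∈? S)
  ... | true = cong suc (shift L)
  ... | false = shift L

length-filter-∈ : ∀ {n} (S : Subset n) → length (filter (_∈? S) (allFin n)) ≡ ∣ S ∣
length-filter-∈ {zero} [] = refl
length-filter-∈ {suc n} (inside ∷ S) = cong suc (trans (length-filter-tail inside S) (length-filter-∈ S))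
length-filter-∈ {suc n} (outside ∷ S) = trans (length-filter-tail outside S) (length-filter-∈ S)

-- The arithmetic of the converse inclusion, with m = |S| and n - m deleted
-- variables: m < d + (k ∸ (n-m)·s) together with d ≤ m forces
-- d ≥ n - k + 1 + (n-m)(s-1).
deletion-budget : ∀ {n k m d} s′ → k ≤ n → m ≤ n → d ≤ m → m < d + (k ∸ (n ∸ m) * suc s′) →
  suc (n ∸ k) + (n ∸ m) * s′ ≤ d
deletion-budget {n} {k} {m} {d} s′ k≤n m≤n d≤m m<d+t with k ≤? (n ∸ m) * suc s′
... | yes k≤es = ⊥-elim (NP.<⇒≱ m<d+t (subst (_≤ m) (sym d+0≡d) d≤m))
  where
  d+0≡d : d + (k ∸ (n ∸ m) * suc s′) ≡ d
  d+0≡d = trans (cong (d +_) (NP.m≤n⇒m∸n≡0 k≤es)) (NP.+-identityʳ d)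
... | no k≰es = NP.+-cancelʳ-≤ k (suc (n ∸ k) + e * s′) d (subst (_≤ d + k) (sym both-sides) shifted)
  where
  e : ℕ
  e = n ∸ m
  shifted : suc m + e * suc s′ ≤ d + k
  shifted = subst (suc m + e * suc s′ ≤_)
                  (trans (NP.+-assoc d _ _) (cong (d +_) (NP.m∸n+n≡m (NP.<⇒≤ (NP.≰⇒> k≰es)))))
                  (NP.+-monoˡ-≤ (e * suc s′) m<d+t)
  regroupˡ : ∀ a e s′ k → (suc a + e * s′) + k ≡ suc (a + k) + e * s′
  regroupˡ = solve-∀
  regroupʳ : ∀ m e s′ → suc m + e * suc s′ ≡ suc (e + m) + e * s′
  regroupʳ = solve-∀
  -- both sides equal n + 1 + (n - m)(s - 1)
  both-sides : (suc (n ∸ k) + e * s′) + k ≡ suc m + e * suc s′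
  both-sides = begin
    (suc (n ∸ k) + e * s′) + k ≡⟨ regroupˡ (n ∸ k) e s′ k ⟩
    suc (n ∸ k + k) + e * s′   ≡⟨ cong (λ z → suc z + e * s′) (NP.m∸n+n≡m k≤n) ⟩
    suc n + e * s′             ≡⟨ cong (λ z → suc z + e * s′) (NP.m∸n+n≡m m≤n) ⟨
    suc (e + m) + e * s′       ≡⟨ regroupʳ m e s′ ⟨
    suc m + e * suc s′         ∎
    where open ≡-Reasoning

module Inclusions {n k s′ : ℕ} (k≤n : k ≤ n) where

  s : ℕ
  s = suc s′

  NKS Lam : Poly n → Set
  NKS = GenNKS n k s
  Lam = GenLam n s (lamKS k s)

  -- e_d is e_d([n]), and T(n) = k turns the condition n < d + T(n) into d ≥ n - k + 1
  nks-gen-in-lam : ∀ {g} → NKS g → InIdeal Lam g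
  nks-gen-in-lam (inj₂ (i , refl)) = Ideal.mem-gen Lam (inj₂ (i , refl))
  nks-gen-in-lam (inj₁ (d , n-k<d , _ , refl)) =
    Ideal.mem-gen Lam (inj₁ (⊤ , d , condition , cong (esymL d) (sym (filter-∈⊤ n))))
    where
    condition : ∣ ⊤ {n} ∣ < d + tailConjSum (lamKS k s) n ∣ ⊤ {n} ∣
    condition rewrite ∣⊤∣≡n n | tailConjSum-lamKS s′ n k≤n NP.≤-refl | NP.n∸n≡0 n =
      subst (_≤ d + k) (NP.m∸n+n≡m (NP.m≤n⇒m≤1+n k≤n)) (NP.+-monoˡ-≤ k n-k<d)

  open Deletion NKS s′ (λ y → Ideal.mem-gen NKS (inj₂ (y , refl)))

  -- I_{n,k,s} contains e_d(x₁,…,xₙ) for every d ≥ n - k + 1 (those with d > n vanish)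
  esym-in-nks : ∀ d → suc (n ∸ k) ≤ d → InIdeal NKS (esymL d (allFin n))
  esym-in-nks d n-k<d with d ≤? n
  ... | yes d≤n = Ideal.mem-gen NKS (inj₁ (d , subst (_≤ d) (sym (NP.+-∸-assoc 1 k≤n)) n-k<d , d≤n , refl))
  ... | no d≰n = Ideal.mem-vanishing NKS {esymL d (allFin n)}
                   (esym-vanish d (allFin n) (subst (_< d) (sym (length-allFin n)) (NP.≰⇒> d≰n)))

  -- e_d(S) arises from the e_d(x₁,…,xₙ) by deleting the n - |S| variables outside S
  lam-gen-in-nks : ∀ {g} → Lam g → InIdeal NKS g
  lam-gen-in-nks (inj₂ (i , refl)) = Ideal.mem-gen NKS (inj₂ (i , refl))
  lam-gen-in-nks (inj₁ (S , d , condition , refl)) with d ≤? ∣ S ∣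
  ... | no d≰|S| = Ideal.mem-vanishing NKS {esymS d S}
                     (esym-vanish d (filter (_∈? S) (allFin n))
                       (subst (_< d) (sym (length-filter-∈ S)) (NP.≰⇒> d≰|S|)))
  ... | yes d≤|S| = delete-all (filter-⊆ (_∈? S) (allFin n)) [] (suc (n ∸ k)) esym-in-nks d budget
    where
    budget : suc (n ∸ k) + (length (allFin n) ∸ length (filter (_∈? S) (allFin n))) * s′ ≤ d
    budget rewrite length-allFin n | length-filter-∈ S =
      deletion-budget s′ k≤n (∣p∣≤n S) d≤|S|
        (subst (λ t → ∣ S ∣ < d + t) (tailConjSum-lamKS s′ ∣ S ∣ k≤n (∣p∣≤n S)) condition)

proposition4p11 : (n k s : ℕ) → 1 ≤ n → 1 ≤ k → 1 ≤ s → k ≤ n →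
    SameIdeal (GenNKS n k s) (GenLam n s (lamKS k s))
proposition4p11 n k (suc s′) _ _ _ k≤n f =
  mk⇔ (ideal-mono nks-gen-in-lam {f}) (ideal-mono lam-gen-in-nks {f})
  where open Inclusions {n} {k} {s′} k≤n
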